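{- For all terms $r,s$: if $r\rightleftarrows s$ then $P(r)=P(s)$.
   Context: Types: $A,B,C::=\tau\mid A\Rightarrow B\mid A\wedge B$ with a single atomic type $\tau$. $\equiv$ is the smallest congruence on types containing $A\wedge B\equiv B\wedge A$, $(A\wedge B)\wedge C\equiv A\wedge(B\wedge C)$, $A\Rightarrow(B\wedge C)\equiv(A\Rightarrow B)\wedge(A\Rightarrow C)$, $(A\wedge B)\Rightarrow C\equiv A\Rightarrow B\Rightarrow C$. Terms: $r,s,t::=x^A\mid \lambda x^A.r\mid r\,s\mid r+s\mid \pi_A(r)$; every variable occurrence carries a type label; terms up to $\alpha$-equivalence. $\mathrm{vars}(r)$ is the set of labelled variables of $r$; a set of labelled variables is functional if $x^A,x^B$ in it implies $A=B$. $r[A/B]$ replaces every syntactic occurrence of type $B$ in $r$ by $A$. Typing (judgements $r:A$): $x^A:A$; if $r:A$ and $A\equiv B$ then $r:B$; if $r:B$ and $\mathrm{vars}(r)\cup\{x^A\}$ functional then $\lambda x^A.r:A\Rightarrow B$; if $r:A\Rightarrow B$, $s:A$, $\mathrm{vars}(rs)$ functional then $rs:B$; if $r:A$, $s:B$, $\mathrm{vars}(r+s)$ functional then $r+s:A\wedge B$; if $r:A$ then $\pi_A(r):A$; if $r:A\wedge B$ then $\pi_A(r):A$. The relation $\rightleftarrows$ is the closure under contexts $C[\cdot]::=[\cdot]\mid\lambda x^A.C[\cdot]\mid C[\cdot]r\mid rC[\cdot]\mid C[\cdot]+r\mid r+C[\cdot]\mid\pi_A(C[\cdot])$ (if $r\rightleftarrows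 s$ then $C[r]\rightleftarrows C[s]$) of the following rules, each used in both directions: $r+s\rightleftarrows s+r$; $(r+s)+t\rightleftarrows r+(s+t)$; $\lambda x^A.(r+s)\rightleftarrows\lambda x^A.r+\lambda x^A.s$; $(r+s)t\rightleftarrows rt+st$; $\pi_{A\Rightarrow B}(\lambda x^A.r)\rightleftarrows\lambda x^A.\pi_B(r)$; if $r:A\Rightarrow(B\wedge C)$ then $\pi_{A\Rightarrow B}(r)s\rightleftarrows\pi_B(rs)$; $(rs)t\rightleftarrows r(s+t)$; if $A\equiv B$ then $r\rightleftarrows r[A/B]$; if $r:A\wedge B$ and $s:C\wedge D$ then $\pi_{A\wedge C}(r+s)\rightleftarrows\pi_A(r)+\pi_C(s)$. $P$ is defined by: $P(x^A)=0$, $P(\lambda x^A.r)=P(r)$, $P(rs)=P(r)$, $P(r+s)=1+P(r)+P(s)$, $P(\pi_A(r))=P(r)$. -}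

module Defs where

open import Data.Nat using (ℕ; zero; suc; _+_)
open import Data.Product using (_×_; _,_)
open import Data.List using (List; []; _∷_; _++_; [_])
open import Data.List.Membership.Propositional using (_∈_)
open import Relation.Binary.PropositionalEquality using (_≡_; refl; cong₂)
open import Relation.Nullary using (Dec; yes; no)

infixr 7 _⇒_
infixr 8 _∧_

data Ty : Set where
  τ   : Ty
  _⇒_ : Ty → Ty → Ty
  _∧_ : Ty → Ty → Ty

_≟Ty_ : (A B : Ty) → Dec (A ≡ B)
τ ≟Ty τ = yes refl
τ ≟Ty (B ⇒ B₁) = no (λ ())
τ ≟Ty (B ∧ B₁) = no (λ ())
(A ⇒ A₁) ≟Ty τ = no (λ ())
(A ⇒ A₁) ≟Ty (B ∧ B₁) = no (λ ())
(A ∧ A₁) ≟Ty τ = no (λ ())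
(A ∧ A₁) ≟Ty (B ⇒ B₁) = no (λ ())
(A ⇒ A₁) ≟Ty (B ⇒ B₁) with A ≟Ty B | A₁ ≟Ty B₁
... | yes p | yes q = yes (cong₂ _⇒_ p q)
... | no ¬p | _ = no (λ { refl → ¬p refl })
... | yes _ | no ¬q = no (λ { refl → ¬q refl })
(A ∧ A₁) ≟Ty (B ∧ B₁) with A ≟Ty B | A₁ ≟Ty B₁
... | yes p | yes q = yes (cong₂ _∧_ p q)
... | no ¬p | _ = no (λ { refl → ¬p refl })
... | yes _ | no ¬q = no (λ { refl → ¬q refl })

infix 4 _≅_
data _≅_ : Ty → Ty → Set where
  ≅-refl  : ∀ {A} → A ≅ A
  ≅-sym   : ∀ {A B} → A ≅ B → B ≅ A
  ≅-trans : ∀ {A B C} → A ≅ B → B ≅ C → A ≅ C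
  ≅-⇒     : ∀ {A A' B B'} → A ≅ A' → B ≅ B' → (A ⇒ B) ≅ (A' ⇒ B')
  ≅-∧     : ∀ {A A' B B'} → A ≅ A' → B ≅ B' → (A ∧ B) ≅ (A' ∧ B')
  ≅-comm  : ∀ {A B} → (A ∧ B) ≅ (B ∧ A)
  ≅-asso  : ∀ {A B C} → ((A ∧ B) ∧ C) ≅ (A ∧ (B ∧ C))
  ≅-dist  : ∀ {A B C} → (A ⇒ (B ∧ C)) ≅ ((A ⇒ B) ∧ (A ⇒ C))
  ≅-curry : ∀ {A B C} → ((A ∧ B) ⇒ C) ≅ (A ⇒ (B ⇒ C))

Var : Set
Var = ℕ

infixl 6 _⊕_
infixl 9 _·_
data Tm : Set where
  var : Var → Ty → Tm
  lam : Var → Ty → Tm → Tm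
  _·_ : Tm → Tm → Tm
  _⊕_ : Tm → Tm → Tm
  π   : Ty → Tm → Tm

vars : Tm → List (Var × Ty)
vars (var x A)   = [ (x , A) ]
vars (lam x A r) = (x , A) ∷ vars r
vars (r · s)     = vars r ++ vars s
vars (r ⊕ s)     = vars r ++ vars s
vars (π A r)     = vars r

Functional : List (Var × Ty) → Set
Functional vs = ∀ x A B → (x , A) ∈ vs → (x , B) ∈ vs → A ≡ B

infix 4 _∶_
data _∶_ : Tm → Ty → Set where
  ty-var : ∀ {x A} → var x A ∶ A
  ty-≅   : ∀ {r A B} → r ∶ A → A ≅ B → r ∶ B
  ty-lam : ∀ {x A r B} → r ∶ B → Functional ((x , A) ∷ vars r) → lam x A r ∶ (A ⇒ B)
  ty-app : ∀ {r s A B} → r ∶ (A ⇒ B) → s ∶ A → Functional (vars (r · s)) → r · s ∶ B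
  ty-sum : ∀ {r s A B} → r ∶ A → s ∶ B → Functional (vars (r ⊕ s)) → r ⊕ s ∶ (A ∧ B)
  ty-π   : ∀ {r A} → r ∶ A → π A r ∶ A
  ty-π∧  : ∀ {r A B} → r ∶ (A ∧ B) → π A r ∶ A

substTy : Ty → Ty → Ty → Ty
substTy A B C with C ≟Ty B
... | yes _ = A
substTy A B τ       | no _ = τ
substTy A B (C ⇒ D) | no _ = substTy A B C ⇒ substTy A B D
substTy A B (C ∧ D) | no _ = substTy A B C ∧ substTy A B D

_[_/_] : Tm → Ty → Ty → Tm
var x C   [ A / B ] = var x (substTy A B C)
lam x C r [ A / B ] = lam x (substTy A B C) (r [ A / B ])
(r · s)   [ A / B ] = (r [ A / B ]) · (s [ A / B ])
(r ⊕ s)   [ A / B ] = (r [ A / B ]) ⊕ (s [ A / B ])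
π C r     [ A / B ] = π (substTy A B C) (r [ A / B ])

infix 4 _↦_
data _↦_ : Tm → Tm → Set where
  comm   : ∀ {r s} → r ⊕ s ↦ s ⊕ r
  asso   : ∀ {r s t} → (r ⊕ s) ⊕ t ↦ r ⊕ (s ⊕ t)
  distλ  : ∀ {x A r s} → lam x A (r ⊕ s) ↦ lam x A r ⊕ lam x A s
  distapp : ∀ {r s t} → (r ⊕ s) · t ↦ (r · t) ⊕ (s · t)
  πλ     : ∀ {x A B r} → π (A ⇒ B) (lam x A r) ↦ lam x A (π B r)
  πapp   : ∀ {r s A B C} → r ∶ (A ⇒ (B ∧ C)) → π (A ⇒ B) r · s ↦ π B (r · s)
  curry  : ∀ {r s t} → (r · s) · t ↦ r · (s ⊕ t)
  subst  : ∀ {r A B} → A ≅ B → r ↦ r [ A / B ]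
  dist+  : ∀ {r s A B C D} → r ∶ (A ∧ B) → s ∶ (C ∧ D) →
           π (A ∧ C) (r ⊕ s) ↦ π A r ⊕ π C s

infix 4 _⇄_
data _⇄_ : Tm → Tm → Set where
  fwd  : ∀ {r s} → r ↦ s → r ⇄ s
  bwd  : ∀ {r s} → s ↦ r → r ⇄ s
  c-lam : ∀ {x A r s} → r ⇄ s → lam x A r ⇄ lam x A s
  c-appl : ∀ {r s t} → r ⇄ s → r · t ⇄ s · t
  c-appr : ∀ {r s t} → r ⇄ s → t · r ⇄ t · s
  c-sumr : ∀ {r s t} → r ⇄ s → r ⊕ t ⇄ s ⊕ t
  c-suml : ∀ {r s t} → r ⇄ s → t ⊕ r ⇄ t ⊕ s
  c-π    : ∀ {A r s} → r ⇄ s → π A r ⇄ π A s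

P : Tm → ℕ
P (var x A)   = 0
P (lam x A r) = P r
P (r · s)     = P r
P (r ⊕ s)     = 1 + P r + P s
P (π A r)     = P r

-- P counts the +'s of a term that do not lie inside an application argument.
-- Commutativity and associativity of + only rearrange such +'s, type
-- substitution is invisible to P, and every other rule (currying included,
-- whose new + sits in an argument) leaves them untouched; P is compositional,
-- so invariance passes through contexts.
module Submission where

open import Defs
open import Data.Nat using (suc; _+_)
open import Data.Nat.Properties using (+-comm; +-assoc; +-suc)
open import Relation.Binary.PropositionalEquality
  using (_≡_; refl; sym; cong; cong₂; module ≡-Reasoning)

P-[/] : ∀ r A B → P (r [ A / B ]) ≡ P r
P-[/] (var x C)   A B = refl
P-[/] (lam x C r) A B = P-[/] r A B
P-[/] (r · s)     A B = P-[/] r A B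
P-[/] (r ⊕ s)     A B = cong₂ (λ m n → suc (m + n)) (P-[/] r A B) (P-[/] s A B)
P-[/] (π C r)     A B = P-[/] r A B

P-⊕-assoc : ∀ r s t → P ((r ⊕ s) ⊕ t) ≡ P (r ⊕ (s ⊕ t))
P-⊕-assoc r s t = cong suc (begin
  suc (P r + P s) + P t   ≡⟨ cong suc (+-assoc (P r) (P s) (P t)) ⟩
  suc (P r + (P s + P t)) ≡⟨ sym (+-suc (P r) (P s + P t)) ⟩
  P r + suc (P s + P t)   ∎)
  where open ≡-Reasoning

P-resp-↦ : ∀ {r s} → r ↦ s → P r ≡ P s
P-resp-↦ (comm {r} {s})         = cong suc (+-comm (P r) (P s))
P-resp-↦ (asso {r} {s} {t})     = P-⊕-assoc r s t
P-resp-↦ distλ                  = refl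
P-resp-↦ distapp                = refl
P-resp-↦ πλ                     = refl
P-resp-↦ (πapp _)               = refl
P-resp-↦ curry                  = refl
P-resp-↦ (subst {r} {A} {B} _)  = sym (P-[/] r A B)
P-resp-↦ (dist+ _ _)            = refl

P-resp-⇄ : ∀ {r s} → r ⇄ s → P r ≡ P s
P-resp-⇄ (fwd r↦s)            = P-resp-↦ r↦s
P-resp-⇄ (bwd s↦r)            = sym (P-resp-↦ s↦r)
P-resp-⇄ (c-lam r⇄s)          = P-resp-⇄ r⇄s
P-resp-⇄ (c-appl r⇄s)         = P-resp-⇄ r⇄s
P-resp-⇄ (c-appr _)           = refl
P-resp-⇄ (c-sumr {t = t} r⇄s) = cong (λ n → suc (n + P t)) (P-resp-⇄ r⇄s)
P-resp-⇄ (c-suml {t = t} r⇄s) = cong (λ n → suc (P t + n)) (P-resp-⇄ r⇄s)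
P-resp-⇄ (c-π r⇄s)            = P-resp-⇄ r⇄s

lemma2 : (r s : Tm) → r ⇄ s → P r ≡ P s
lemma2 _ _ = P-resp-⇄
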